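{- Let $P$ be a poset and $\mathscr{X}=\{X_p\mid p\in P\}$ a complete $P$-partition of the topological space $W$, with label function $\tau:W\to P$ given by $\tau(w)=p$ for $w\in X_p$. Give $P$ the topology in which the open sets are the upper sets. Then $\mathscr{X}$ is a trim $P$-partition of $W$ if and only if (i) $\tau$ is continuous and (ii) $\tau(A)$ is open in $P$ whenever $A$ is open in $W$.
   Context: Let $(P,\le)$ be a poset and $W$ a topological space. A $P$-partition of $W$ is a family $\{X_p\mid p\in P\}$ of pairwise disjoint non-empty subsets of $W$; it is complete if their union is $W$. For $Y\subseteq W$, $T(Y)=\{p: Y\cap X_p\neq\emptyset\}$. An open set $A$ is $p$-trim ($t(A)=p$) if $T(A)=\{q:q\ge p\}$, trim if $p$-trim for some $p$. $\widehat P=\{p: W$ contains a $p$-trim set$\}$. The partition is semi-trim if: every point of $W$ has a neighbourhood base of trim sets; if $A$ is open and $p\in T(A)\cap\widehat P$ then $A$ contains a $p$-trim subset; if $x\in X_p$ then $p=\sup_P\{t(A): A\text{ trim}, x\in A\}$; and for each $p$ every point with a neighbourhood base of $p$-trim sets lies in $X_p$. It is trim if moreover every $x\in\bigcup_p X_p$, say $x\in X_p$, has a $p$-trim neighbourhood. An upper set $U$ satisfies $q\ge u\in U\Rightarrow q\in U$. -}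

module Defs where

open import Level using (Level; _⊔_; suc; Lift; lift)
open import Data.Unit using (⊤; tt)
open import Data.Empty using (⊥)
open import Data.Product using (Σ; ∃; _×_; _,_; proj₁; proj₂)
open import Relation.Unary using (Pred; _∈_; _⊆_; _∩_)
open import Relation.Binary.Core using (Rel)
open import Relation.Binary.PropositionalEquality using (_≡_)
open import Relation.Binary.Structures using (IsPartialOrder)
open import Function.Bundles using (_⇔_)

-- Subsets of W are predicates `Pred W ℓ`; the family of open sets is
-- closed under extensional equality of predicates, contains W, and is
-- closed under binary intersections and arbitrary (Set ℓ-indexed) unions
-- (the empty set is the union of the empty family).

Whole : ∀ {ℓ} (W : Set ℓ) → Pred W ℓ
Whole {ℓ} W _ = Lift ℓ ⊤

record Topology {ℓ : Level} (W : Set ℓ) : Set (suc ℓ) where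
  field
    Open       : Pred W ℓ → Set ℓ
    open-ext   : ∀ {A B : Pred W ℓ} → A ⊆ B → B ⊆ A → Open A → Open B
    open-whole : Open (Whole W)
    open-∩     : ∀ {A B : Pred W ℓ} → Open A → Open B → Open (A ∩ B)
    open-⋃     : ∀ {I : Set ℓ} (U : I → Pred W ℓ) →
                 (∀ i → Open (U i)) → Open (λ w → Σ I (λ i → U i w))

open Topology public

preimage : ∀ {ℓ} {A B : Set ℓ} → (A → B) → Pred B ℓ → Pred A ℓ
preimage f U a = U (f a)

image : ∀ {ℓ} {A B : Set ℓ} → (A → B) → Pred A ℓ → Pred B ℓ
image f S b = ∃ λ a → S a × f a ≡ b

Continuous : ∀ {ℓ} {A B : Set ℓ} → Topology A → Topology B → (A → B) → Set (suc ℓ)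
Continuous TA TB f = ∀ (U : Pred _ _) → Open TB U → Open TA (preimage f U)

OpenMap : ∀ {ℓ} {A B : Set ℓ} → Topology A → Topology B → (A → B) → Set (suc ℓ)
OpenMap TA TB f = ∀ (S : Pred _ _) → Open TA S → Open TB (image f S)

module _ {ℓ : Level} {P : Set ℓ} (_≤_ : Rel P ℓ) where

  UpperSet : Pred P ℓ → Set ℓ
  UpperSet U = ∀ {u q} → U u → u ≤ q → U q

  upperTopology : Topology P
  upperTopology = record
    { Open       = UpperSet
    ; open-ext   = λ A⊆B B⊆A upA Bu u≤q → A⊆B (upA (B⊆A Bu) u≤q)
    ; open-whole = λ _ _ → lift tt
    ; open-∩     = λ upA upB (Au , Bu) u≤q → upA Au u≤q , upB Bu u≤q
    ; open-⋃     = λ U upU (i , Uiu) u≤q → i , upU i Uiu u≤q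
    }

record PPartition {ℓ : Level} (P : Set ℓ) (W : Set ℓ) : Set (suc ℓ) where
  field
    X        : P → Pred W ℓ
    disjoint : ∀ {p q w} → X p w → X q w → p ≡ q
    nonempty : ∀ p → ∃ λ w → X p w

open PPartition public

-- Complete, witnessed by the label function τ : W → P with w ∈ X_{τ(w)}.
IsLabelFunction : ∀ {ℓ} {P W : Set ℓ} → PPartition P W → (W → P) → Set ℓ
IsLabelFunction 𝒳 τ = ∀ w → X 𝒳 (τ w) w

module _ {ℓ : Level} {P W : Set ℓ} (_≤_ : Rel P ℓ)
         (TW : Topology W) (𝒳 : PPartition P W) where

  T : Pred W ℓ → Pred P ℓ
  T Y p = ∃ λ w → Y w × X 𝒳 p w

  IsPTrim : P → Pred W ℓ → Set ℓ
  IsPTrim p A = Open TW A × (∀ q → (T A q → p ≤ q) × (p ≤ q → T A q))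

  IsTrimSet : Pred W ℓ → Set ℓ
  IsTrimSet A = ∃ λ p → IsPTrim p A

  Phat : Pred P (suc ℓ)
  Phat p = ∃ λ (A : Pred W ℓ) → IsPTrim p A

  HasNbhdBase : (Pred W ℓ → Set ℓ) → W → Set (suc ℓ)
  HasNbhdBase 𝒮 x = ∀ (U : Pred W ℓ) → Open TW U → U x →
                    ∃ λ (A : Pred W ℓ) → 𝒮 A × A x × A ⊆ U

  IsSupOfTrimLabels : P → W → Set (suc ℓ)
  IsSupOfTrimLabels p x =
      (∀ q (A : Pred W ℓ) → IsPTrim q A → A x → q ≤ p)
    × (∀ u → (∀ q (A : Pred W ℓ) → IsPTrim q A → A x → q ≤ u) → p ≤ u)

  record IsSemiTrim : Set (suc ℓ) where
    field
      trimBase  : ∀ x → HasNbhdBase IsTrimSet x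
      trimInside : ∀ (A : Pred W ℓ) p → Open TW A → T A p → Phat p →
                   ∃ λ (B : Pred W ℓ) → B ⊆ A × IsPTrim p B
      labelSup  : ∀ p x → X 𝒳 p x → IsSupOfTrimLabels p x
      baseLabel : ∀ p x → HasNbhdBase (IsPTrim p) x → X 𝒳 p x

  record IsTrimPartition : Set (suc ℓ) where
    field
      semiTrim : IsSemiTrim
      trimNbhd : ∀ p x → X 𝒳 p x → ∃ λ (A : Pred W ℓ) → IsPTrim p A × A x

-- With the label function τ, T(A) is just the image τ(A), so an open set A is
-- p-trim exactly when τ(A) = ↑p.  If the partition is trim, every x has an open
-- τ(x)-trim neighbourhood; this makes τ⁻¹(U) a union of open sets for an upper
-- set U, and a trim neighbourhood B ⊆ S of x shows ↑τ(x) ⊆ τ(S).  Conversely, if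
-- τ is continuous and open then, for U open and x ∈ U ∩ X_p, the open set
-- U ∩ τ⁻¹(↑p) is p-trim: its image lies in ↑p, and ↑p ⊆ τ(U) because τ(U) is an
-- upper set containing p.  Such sets provide all trim sets the axioms ask for.
module Submission where

open import Defs
open import Relation.Binary.Core using (Rel)
open import Relation.Binary.PropositionalEquality using (_≡_; refl; subst)
open import Relation.Binary.Structures using (IsPartialOrder)
open import Data.Product using (_×_; _,_; proj₁; proj₂; Σ; ∃)
open import Function.Bundles using (_⇔_; mk⇔)
open import Level using (lift)
open import Relation.Unary using (Pred; _⊆_; _∩_)

open-if-locally-open : ∀ {ℓ} {W : Set ℓ} (TW : Topology W) {U : Pred W ℓ} →
                       (∀ {x} → U x → ∃ λ (A : Pred W ℓ) → Open TW A × A x × A ⊆ U) →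
                       Open TW U
open-if-locally-open TW {U} local =
  open-ext TW (λ ((_ , Ux) , Ax) → proj₂ (proj₂ (proj₂ (local Ux))) Ax)
              (λ {x} Ux → (x , Ux) , proj₁ (proj₂ (proj₂ (local Ux))))
              (open-⋃ TW (λ ((_ , Ux) : Σ _ U) → proj₁ (local Ux))
                         (λ (_ , Ux) → proj₁ (proj₂ (local Ux))))

module LabelledPartition {ℓ} {P W : Set ℓ} (_≤_ : Rel P ℓ)
    (po : IsPartialOrder _≡_ _≤_) (TW : Topology W) (𝒳 : PPartition P W)
    (τ : W → P) (lab : IsLabelFunction 𝒳 τ) where

  open IsPartialOrder po using (trans; antisym) renaming (refl to ≤-refl)

  private
    PTrim : P → Pred W ℓ → Set ℓ
    PTrim = IsPTrim _≤_ TW 𝒳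
    ↑ : P → Pred P ℓ
    ↑ p q = p ≤ q

  label-unique : ∀ {p w} → X 𝒳 p w → τ w ≡ p
  label-unique = disjoint 𝒳 (lab _)

  label⇒X : ∀ {p w} → τ w ≡ p → X 𝒳 p w
  label⇒X refl = lab _

  T⇒image : ∀ {A q} → T _≤_ TW 𝒳 A q → image τ A q
  T⇒image (w , Aw , Xqw) = w , Aw , label-unique Xqw

  image⇒T : ∀ {A q} → image τ A q → T _≤_ TW 𝒳 A q
  image⇒T (w , Aw , refl) = w , Aw , lab w

  ≤-label : ∀ {p A w} → PTrim p A → A w → p ≤ τ w
  ≤-label {w = w} At Aw = proj₁ (proj₂ At (τ w)) (image⇒T (w , Aw , refl))

  ↑⊆image : ∀ {p A} → PTrim p A → ↑ p ⊆ image τ A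
  ↑⊆image At {q} p≤q = T⇒image (proj₂ (proj₂ At q) p≤q)

  module FromTrim (trim : IsTrimPartition _≤_ TW 𝒳) where
    open IsTrimPartition trim
    open IsSemiTrim semiTrim

    continuous : Continuous TW (upperTopology _≤_) τ
    continuous U U-upper = open-if-locally-open TW λ {x} Ux →
      let A , At , Ax = trimNbhd (τ x) x (lab x)
      in A , proj₁ At , Ax , λ Aw → U-upper Ux (≤-label At Aw)

    openMap : OpenMap TW (upperTopology _≤_) τ
    openMap S S-open (x , Sx , refl) τx≤q with trimBase x S S-open Sx
    ... | B , (_ , Bt) , Bx , B⊆S with ↑⊆image Bt (trans (≤-label Bt Bx) τx≤q)
    ...   | w , Bw , τw≡q = w , B⊆S Bw , τw≡q

  module FromOpenContinuous (cont : Continuous TW (upperTopology _≤_) τ)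
                            (opn : OpenMap TW (upperTopology _≤_) τ) where

    above-open : ∀ p → Open TW (preimage τ (↑ p))
    above-open p = cont (↑ p) trans

    cut : Pred W ℓ → P → Pred W ℓ
    cut U p = U ∩ preimage τ (↑ p)

    cut-trim : ∀ {U p x} → Open TW U → U x → X 𝒳 p x → PTrim p (cut U p)
    cut-trim {U} {p} {x} U-open Ux Xpx =
      open-∩ TW U-open (above-open p) , λ q → (λ t → image⊆↑ (T⇒image t)) , ↑⊆T
      where
        image⊆↑ : ∀ {q} → image τ (cut U p) q → p ≤ q
        image⊆↑ (_ , (_ , p≤τw) , refl) = p≤τw
        ↑⊆T : ∀ {q} → p ≤ q → T _≤_ TW 𝒳 (cut U p) q
        ↑⊆T p≤q with opn U U-open (x , Ux , label-unique Xpx) p≤q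
        ... | w , Uw , refl = image⇒T (w , (Uw , p≤q) , refl)

    whole-trim : ∀ {p x} → X 𝒳 p x → PTrim p (cut (Whole W) p)
    whole-trim = cut-trim (open-whole TW) (lift _)

    in-own-cut : ∀ {U p x} → U x → X 𝒳 p x → cut U p x
    in-own-cut Ux Xpx with label-unique Xpx
    ... | refl = Ux , ≤-refl

    trimPartition : IsTrimPartition _≤_ TW 𝒳
    trimPartition = record
      { semiTrim = record
        { trimBase   = λ x U U-open Ux →
            cut U (τ x) , (τ x , cut-trim U-open Ux (lab x)) , in-own-cut {U} Ux (lab x) , proj₁
        ; trimInside = λ { A p A-open (w , Aw , Xpw) _ →
            cut A p , proj₁ , cut-trim A-open Aw Xpw }
        ; labelSup   = λ p x Xpx →
            (λ q A At Ax → subst (q ≤_) (label-unique Xpx) (≤-label At Ax))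
          , (λ u bound → bound p (cut (Whole W) p) (whole-trim Xpx) (in-own-cut {Whole W} (lift _) Xpx))
        ; baseLabel  = baseLabel
        }
      ; trimNbhd = λ p x Xpx → cut (Whole W) p , whole-trim Xpx , in-own-cut {Whole W} (lift _) Xpx
      }
      where
        baseLabel : ∀ p x → HasNbhdBase _≤_ TW 𝒳 (PTrim p) x → X 𝒳 p x
        baseLabel p x base with base (preimage τ (↑ (τ x))) (above-open (τ x)) ≤-refl
        ... | A , At , Ax , A⊆↑τx with ↑⊆image At ≤-refl
        ...   | w , Aw , refl = label⇒X (antisym (A⊆↑τx Aw) (≤-label At Ax))

proposition2p5 : ∀ {ℓ} {P W : Set ℓ} (_≤_ : Rel P ℓ) → IsPartialOrder _≡_ _≤_ →
                 (TW : Topology W) (𝒳 : PPartition P W) (τ : W → P) →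
                 IsLabelFunction 𝒳 τ →
                 IsTrimPartition _≤_ TW 𝒳 ⇔
                   (Continuous TW (upperTopology _≤_) τ
                     × OpenMap TW (upperTopology _≤_) τ)
proposition2p5 _≤_ po TW 𝒳 τ lab =
  mk⇔ (λ trim → FromTrim.continuous trim , FromTrim.openMap trim)
      (λ (cont , opn) → FromOpenContinuous.trimPartition cont opn)
  where open LabelledPartition _≤_ po TW 𝒳 τ lab
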